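{- Let $p$ be a prime with $p>5$, and let $G=\langle x,y \mid x^{p^2}=y^5=1,\ y^{ -1}xy=x^i\rangle$, where $i^5\equiv 1 \pmod{p^2}$. Then there is no $4$-valent one-regular normal Cayley graph $X$ of order $5p^2$ on $G$.
   Context: Graphs are finite, undirected, without loops or multiple edges. For a finite group $G$ and a subset $S\subseteq G$ with $1\notin S$ and $S=S^{ -1}$, the Cayley graph $\mathrm{Cay}(G,S)$ has vertex set $G$ and edges $\{g,sg\}$ for $g\in G$, $s\in S$; it is $|S|$-valent. The right regular representation $R(G)=\{R(g): x\mapsto xg\}$ is a subgroup of $\mathrm{Aut}(\mathrm{Cay}(G,S))$, and the Cayley graph is called normal if $R(G)$ is a normal subgroup of $\mathrm{Aut}(\mathrm{Cay}(G,S))$. A graph is one-regular if its full automorphism group acts regularly on its set of arcs (ordered pairs of adjacent vertices); in particular a one-regular graph is connected. -}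

module Defs where

open import Data.Nat using (ℕ; NonZero; _+_; _*_; _^_)
open import Data.Nat.Properties using (m*n≢0)
open import Data.Nat.DivMod using (_mod_)
open import Data.Nat.Primality using (Prime; prime⇒nonZero)
open import Data.Fin using (Fin; toℕ)
open import Data.Product using (Σ; ∃; _×_; _,_)
open import Data.List using (List)
open import Data.List.Membership.Propositional using (_∈_; _∉_)
open import Data.List.Relation.Unary.Unique.Propositional using (Unique)
open import Relation.Binary.PropositionalEquality using (_≡_)

-- The group G = ⟨ x , y ∣ x^(p²) = y^5 = 1 , y⁻¹ x y = x^i ⟩
-- (for i^5 ≡ 1 mod p²), realised concretely as the semidirect product
-- Z_{p²} ⋊ Z_5: the pair (b , a) stands for the element y^b x^a.
-- From x y = y x^i one gets x^a y^d = y^d x^(a i^d), hence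
--   (y^b x^a)(y^d x^c) = y^(b+d) x^(a i^d + c).
-- This is associative (well defined) exactly because i^5 ≡ 1 (mod p²).

module Metacyclic (p : ℕ) (pp : Prime p) (i : ℕ) where

  private
    instance
      nzp : NonZero p
      nzp = prime⇒nonZero pp
      nzp² : NonZero (p * p)
      nzp² = m*n≢0 p p

  G : Set
  G = Fin 5 × Fin (p * p)

  _·_ : G → G → G
  (b , a) · (d , c) = ((toℕ b + toℕ d) mod 5) , ((toℕ a * i ^ toℕ d + toℕ c) mod (p * p))

  e : G
  e = (0 mod 5) , (0 mod (p * p))

  x y : G
  x = (0 mod 5) , (1 mod (p * p))
  y = (1 mod 5) , (0 mod (p * p))

module Cayley {G : Set} (_·_ : G → G → G) (e : G) where

  IsCayleySubset : List G → Set
  IsCayleySubset S =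
    Unique S × (e ∉ S) × (∀ s → s ∈ S → ∃ λ t → t ∈ S × (t · s) ≡ e)

  Adj : List G → G → G → Set
  Adj S g h = ∃ λ s → s ∈ S × h ≡ (s · g)

  record Aut (S : List G) : Set where
    field
      fun     : G → G
      inv     : G → G
      inv-fun : ∀ g → inv (fun g) ≡ g
      fun-inv : ∀ g → fun (inv g) ≡ g
      pres    : ∀ g h → Adj S g h → Adj S (fun g) (fun h)
      refl'   : ∀ g h → Adj S (fun g) (fun h) → Adj S g h
  open Aut public

  -- one-regular: Aut(Cay(G,S)) acts regularly on arcs, i.e. for any two
  -- arcs (u,v), (u',v') there is exactly one automorphism (up to
  -- pointwise equality) sending (u,v) to (u',v').
  OneRegular : List G → Set
  OneRegular S =
    ∀ u v u' v' → Adj S u v → Adj S u' v' →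
      Σ (Aut S) λ α → (fun α u ≡ u' × fun α v ≡ v') ×
        (∀ (β : Aut S) → fun β u ≡ u' → fun β v ≡ v' → ∀ z → fun β z ≡ fun α z)

  -- normal Cayley graph: R(G) ⊴ Aut(Cay(G,S)), i.e. for every automorphism α
  -- and g ∈ G there is h ∈ G with α ∘ R(g) ∘ α⁻¹ = R(h), where R(g) : z ↦ z g;
  -- equivalently α (z g) = α(z) h for all z.
  IsNormal : List G → Set
  IsNormal S = ∀ (α : Aut S) (g : G) → ∃ λ h → ∀ z → fun α (z · g) ≡ (fun α z · h)

module Submission where

-- If S ⊆ ⟨x⟩, the bijection yᵇxᵃ ↦ yᵇxᵃ⁺ᵇ commutes with left multiplication by S, so it is an
-- automorphism of Cay(G,S) fixing ⟨x⟩ pointwise but moving y: the stabiliser of an arc inside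
-- ⟨x⟩ is non-trivial and the graph is not one-regular. Otherwise pick s ∈ S ∖ ⟨x⟩:
-- one-regularity gives an automorphism α fixing 1 and sending s to s⁻¹, and normality makes α
-- a group automorphism. As 5 ∤ p², α maps x into ⟨x⟩, say α x = xᵘ, and α acts on G/⟨x⟩ ≅ ℤ₅
-- by multiplication by some d; inverting s forces d = −1, i.e. α y ∈ y⁴⟨x⟩. Applying α to
-- x y = y xⁱ then gives x^(u i⁴) = x^(i u), hence x^(i⁴) = xⁱ by injectivity. Finally i⁴ ≡ i and
-- i⁵ ≡ 1 give i² ≡ 1 and so i ≡ i⁵ ≡ 1 (mod p²).

open import Defs
open import Data.Nat
  using (ℕ; NonZero; >-nonZero⁻¹; nonTrivial⇒n>1; zero; suc; _<_; _≤_; _+_; _*_; _∸_; _^_)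
open import Data.Nat.Properties
open import Data.Nat.DivMod
open import Data.Nat.Divisibility using (_∣_; _∤_; m%n≡0⇒n∣m; n∣m⇒m%n≡0; ∣⇒≤; n∣m*n)
open import Data.Nat.Primality
  using (Prime; prime⇒nonZero; prime⇒nonTrivial; composite; euclidsLemma; prime?)
open import Data.Fin as Fin using (Fin; toℕ)
open import Data.Fin.Properties using (toℕ-injective; toℕ-fromℕ<; toℕ<n)
open import Data.Product using (∃; _×_; _,_; proj₁; proj₂)
open import Data.Product.Properties using (×-≡,≡→≡)
open import Data.Sum using ([_,_]′)
open import Data.List using (List; _∷_; []; length)
open import Data.List.Relation.Unary.Any using (here)
open import Data.List.Relation.Unary.All as All using (All; all?)
open import Data.List.Relation.Unary.All.Properties using (¬All⇒Any¬)
open import Data.List.Membership.Propositional using (_∈_; find)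
open import Data.Empty using (⊥)
open import Function using (_∘_)
open import Relation.Nullary using (¬_; Dec; yes; no; contradiction)
open import Relation.Nullary.Decidable using (from-yes)
open import Relation.Binary.PropositionalEquality
  using (_≡_; _≢_; refl; sym; trans; cong; cong₂; module ≡-Reasoning)

∣∧<⇒≡0 : ∀ {q m} .{{_ : NonZero q}} → q ∣ m → m < q → m ≡ 0
∣∧<⇒≡0 {q} {m} q∣m m<q = trans (sym (m<n⇒m%n≡m m<q)) (n∣m⇒m%n≡0 m q q∣m)

prime∣m*n∧∤m⇒∣n : ∀ {q} m n → Prime q → q ∤ m → q ∣ m * n → q ∣ n
prime∣m*n∧∤m⇒∣n m n q-prime q∤m q∣m*n =
  [ (λ q∣m → contradiction q∣m q∤m) , (λ q∣n → q∣n) ]′ (euclidsLemma m n q-prime q∣m*n)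

prime[5] : Prime 5
prime[5] = from-yes (prime? 5)

module Modular (d : ℕ) .{{_ : NonZero d}} where
  open ≡-Reasoning

  toℕ-mod : ∀ m → toℕ (m mod d) ≡ m % d
  toℕ-mod m = toℕ-fromℕ< (m%n<n m d)

  0%d≡0 : 0 % d ≡ 0
  0%d≡0 = m<n⇒m%n≡m (>-nonZero⁻¹ d)

  toℕ-0mod : toℕ (0 mod d) ≡ 0
  toℕ-0mod = trans (toℕ-mod 0) 0%d≡0

  mod-toℕ : ∀ (a : Fin d) → toℕ a mod d ≡ a
  mod-toℕ a = toℕ-injective (trans (toℕ-mod (toℕ a)) (m<n⇒m%n≡m (toℕ<n a)))

  toℕ-mod-% : ∀ m → toℕ (m mod d) % d ≡ m % d
  toℕ-mod-% m = trans (cong (_% d) (toℕ-mod m)) (m%n%n≡m%n m d)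

  %≡%⇒mod≡mod : ∀ {m n} → m % d ≡ n % d → m mod d ≡ n mod d
  %≡%⇒mod≡mod {m} {n} eq = toℕ-injective (trans (toℕ-mod m) (trans eq (sym (toℕ-mod n))))

  [m%d+n]%d≡[m+n]%d : ∀ m n → (m % d + n) % d ≡ (m + n) % d
  [m%d+n]%d≡[m+n]%d m n = begin
    (m % d + n) % d          ≡⟨ %-distribˡ-+ (m % d) n d ⟩
    (m % d % d + n % d) % d  ≡⟨ cong (λ k → (k + n % d) % d) (m%n%n≡m%n m d) ⟩
    (m % d + n % d) % d      ≡⟨ %-distribˡ-+ m n d ⟨
    (m + n) % d              ∎

  [m+n%d]%d≡[m+n]%d : ∀ m n → (m + n % d) % d ≡ (m + n) % d
  [m+n%d]%d≡[m+n]%d m n = begin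
    (m + n % d) % d  ≡⟨ cong (_% d) (+-comm m (n % d)) ⟩
    (n % d + m) % d  ≡⟨ [m%d+n]%d≡[m+n]%d n m ⟩
    (n + m) % d      ≡⟨ cong (_% d) (+-comm n m) ⟩
    (m + n) % d      ∎

  -- Adding d ∸ (o % d) undoes adding o.
  +-cancelʳ-% : ∀ m n o → (m + o) % d ≡ (n + o) % d → m % d ≡ n % d
  +-cancelʳ-% m n o eq = begin
    m % d                  ≡⟨ undo m ⟨
    ((m + o) % d + w) % d  ≡⟨ cong (λ k → (k + w) % d) eq ⟩
    ((n + o) % d + w) % d  ≡⟨ undo n ⟩
    n % d                  ∎
    where
    w = d ∸ o % d
    o+w : o + w ≡ suc (o / d) * d
    o+w = begin
      o + w                      ≡⟨ cong (_+ w) (m≡m%n+[m/n]*n o d) ⟩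
      o % d + (o / d) * d + w    ≡⟨ cong (_+ w) (+-comm (o % d) ((o / d) * d)) ⟩
      (o / d) * d + o % d + w    ≡⟨ +-assoc ((o / d) * d) (o % d) w ⟩
      (o / d) * d + (o % d + w)  ≡⟨ cong ((o / d) * d +_) (m+[n∸m]≡n (m%n≤n o d)) ⟩
      (o / d) * d + d            ≡⟨ +-comm ((o / d) * d) d ⟩
      suc (o / d) * d            ∎
    undo : ∀ k → ((k + o) % d + w) % d ≡ k % d
    undo k = begin
      ((k + o) % d + w) % d    ≡⟨ [m%d+n]%d≡[m+n]%d (k + o) w ⟩
      (k + o + w) % d          ≡⟨ cong (_% d) (+-assoc k o w) ⟩
      (k + (o + w)) % d        ≡⟨ cong (λ l → (k + l) % d) o+w ⟩
      (k + suc (o / d) * d) % d  ≡⟨ [m+kn]%n≡m%n k (suc (o / d)) d ⟩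
      k % d                    ∎

  +-cong-% : ∀ {m m′ n n′} → m % d ≡ m′ % d → n % d ≡ n′ % d → (m + n) % d ≡ (m′ + n′) % d
  +-cong-% {m} {m′} {n} {n′} m≈m′ n≈n′ = begin
    (m + n) % d              ≡⟨ %-distribˡ-+ m n d ⟩
    (m % d + n % d) % d      ≡⟨ cong₂ (λ a b → (a + b) % d) m≈m′ n≈n′ ⟩
    (m′ % d + n′ % d) % d    ≡⟨ %-distribˡ-+ m′ n′ d ⟨
    (m′ + n′) % d            ∎

  *-cong-% : ∀ {m m′ n n′} → m % d ≡ m′ % d → n % d ≡ n′ % d → (m * n) % d ≡ (m′ * n′) % d
  *-cong-% {m} {m′} {n} {n′} m≈m′ n≈n′ = begin
    (m * n) % d              ≡⟨ %-distribˡ-* m n d ⟩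
    (m % d * (n % d)) % d    ≡⟨ cong₂ (λ a b → (a * b) % d) m≈m′ n≈n′ ⟩
    (m′ % d * (n′ % d)) % d  ≡⟨ %-distribˡ-* m′ n′ d ⟨
    (m′ * n′) % d            ∎

  i⁴≡i∧i⁵≡1⇒i≡1 : ∀ i → i ^ 4 % d ≡ i % d → i ^ 5 % d ≡ 1 % d → i % d ≡ 1 % d
  i⁴≡i∧i⁵≡1⇒i≡1 i i⁴≡i i⁵≡1 = begin
    i % d                        ≡⟨ cong (_% d) (*-identityʳ i) ⟨
    (i * 1) % d                  ≡⟨ *-cong-% {i} refl (*-cong-% i²≡1 i²≡1) ⟨
    (i * ((i * i) * (i * i))) % d  ≡⟨ cong (λ k → (i * k) % d) i⁴≡i²i² ⟨
    i ^ 5 % d                    ≡⟨ i⁵≡1 ⟩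
    1 % d                        ∎
    where
    i²≡1 : (i * i) % d ≡ 1 % d
    i²≡1 = trans (*-cong-% {i} refl (sym i⁴≡i)) i⁵≡1
    i⁴≡i²i² : i ^ 4 ≡ (i * i) * (i * i)
    i⁴≡i²i² = trans (^-distribˡ-+-* i 2 2) (cong (λ k → k * k) (cong (i *_) (*-identityʳ i)))

module Powers {G : Set} (_·_ : G → G → G) (e : G) where

  infixr 30 _^ᴳ_

  _^ᴳ_ : G → ℕ → G
  g ^ᴳ zero  = e
  g ^ᴳ suc k = g · (g ^ᴳ k)

  homomorphism-^ᴳ : (f : G → G) → f e ≡ e → (∀ g h → f (g · h) ≡ f g · f h) →
                    ∀ g k → f (g ^ᴳ k) ≡ f g ^ᴳ k
  homomorphism-^ᴳ f f-e f-· g zero    = f-e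
  homomorphism-^ᴳ f f-e f-· g (suc k) =
    trans (f-· g (g ^ᴳ k)) (cong (f g ·_) (homomorphism-^ᴳ f f-e f-· g k))

  +-homomorphism-^ᴳ : (φ : ℕ → G) → φ 0 ≡ e → (∀ a b → φ (a + b) ≡ φ a · φ b) →
                      ∀ a k → φ a ^ᴳ k ≡ φ (k * a)
  +-homomorphism-^ᴳ φ φ-0 φ-+ a zero    = sym φ-0
  +-homomorphism-^ᴳ φ φ-0 φ-+ a (suc k) =
    trans (cong (φ a ·_) (+-homomorphism-^ᴳ φ φ-0 φ-+ a k)) (sym (φ-+ a (k * a)))

module CayleyAutomorphisms {G : Set} (_·_ : G → G → G) (e : G) where
  open Cayley _·_ e

  module _ {S : List G} where

    leftEquivariant⇒Aut : (f f⁻¹ : G → G) → (∀ z → f⁻¹ (f z) ≡ z) → (∀ z → f (f⁻¹ z) ≡ z) →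
                          (∀ {s} → s ∈ S → ∀ z → f (s · z) ≡ s · f z) → Aut S
    leftEquivariant⇒Aut f f⁻¹ f⁻¹∘f f∘f⁻¹ f-equivariant = record
      { fun     = f
      ; inv     = f⁻¹
      ; inv-fun = f⁻¹∘f
      ; fun-inv = f∘f⁻¹
      ; pres    = λ { g h (s , s∈S , h≡sg) →
                    s , s∈S , trans (cong f h≡sg) (f-equivariant s∈S g) }
      ; refl'   = λ { g h (s , s∈S , fh≡s·fg) →
                    s , s∈S , (begin
                      h                ≡⟨ f⁻¹∘f h ⟨
                      f⁻¹ (f h)        ≡⟨ cong f⁻¹ fh≡s·fg ⟩
                      f⁻¹ (s · f g)    ≡⟨ cong f⁻¹ (f-equivariant s∈S g) ⟨
                      f⁻¹ (f (s · g))  ≡⟨ f⁻¹∘f (s · g) ⟩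
                      s · g            ∎) }
      }
      where open ≡-Reasoning

    idAut : Aut S
    idAut = leftEquivariant⇒Aut (λ z → z) (λ z → z) (λ _ → refl) (λ _ → refl) (λ _ _ → refl)

    oneRegular⇒arcStabiliser-trivial : OneRegular S → ∀ {u v} → Adj S u v →
      (β : Aut S) → fun β u ≡ u → fun β v ≡ v → ∀ z → fun β z ≡ z
    oneRegular⇒arcStabiliser-trivial oneRegular uv β βu≡u βv≡v z
      with oneRegular _ _ _ _ uv uv
    ... | α , _ , unique = trans (unique β βu≡u βv≡v z) (sym (unique idAut refl refl z))

    -- Normality says α ∘ R(g) ∘ α⁻¹ = R(h) for some h; evaluating at e gives h = α g.
    normal⇒homomorphism : (∀ g → e · g ≡ g) → IsNormal S → (α : Aut S) → fun α e ≡ e →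
                          ∀ z g → fun α (z · g) ≡ fun α z · fun α g
    normal⇒homomorphism e·g≡g normal α αe≡e z g =
      trans (αR z) (cong (fun α z ·_) (sym αg≡h))
      where
      open ≡-Reasoning
      h = proj₁ (normal α g)
      αR = proj₂ (normal α g)
      αg≡h : fun α g ≡ h
      αg≡h = begin
        fun α g        ≡⟨ cong (fun α) (e·g≡g g) ⟨
        fun α (e · g)  ≡⟨ αR e ⟩
        fun α e · h    ≡⟨ cong (_· h) αe≡e ⟩
        e · h          ≡⟨ e·g≡g h ⟩
        h              ∎

module MetacyclicProperties (p : ℕ) (pp : Prime p) (i : ℕ) where
  open Metacyclic p pp i
  open Powers _·_ e
  open ≡-Reasoning

  instance
    p≢0 : NonZero p
    p≢0 = prime⇒nonZero pp
    p*p≢0 : NonZero (p * p)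
    p*p≢0 = m*n≢0 p p

  n : ℕ
  n = p * p

  open Modular n public
  private module ℤ₅ = Modular 5

  1%n≡1 : 1 % n ≡ 1
  1%n≡1 = m<n⇒m%n≡m (≤-trans (nonTrivial⇒n>1 p {{prime⇒nonTrivial pp}}) (m≤m*n p p))

  -- π is the projection onto G / ⟨x⟩ ≅ ℤ₅, σ reads off the exponent of x.
  π σ : G → ℕ
  π g = toℕ (proj₁ g)
  σ g = toℕ (proj₂ g)

  _∈⟨x⟩ : G → Set
  g ∈⟨x⟩ = proj₁ g ≡ Fin.zero

  _∈⟨x⟩? : ∀ g → Dec (g ∈⟨x⟩)
  g ∈⟨x⟩? = proj₁ g Fin.≟ Fin.zero

  X Y : ℕ → G
  X a = 0 mod 5 , a mod n
  Y b = b mod 5 , 0 mod n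

  π-· : ∀ g h → π (g · h) ≡ (π g + π h) % 5
  π-· g h = ℤ₅.toℕ-mod (π g + π h)

  σ-· : ∀ g h → σ (g · h) ≡ (σ g * i ^ π h + σ h) % n
  σ-· g h = toℕ-mod (σ g * i ^ π h + σ h)

  ·-identityˡ : ∀ g → e · g ≡ g
  ·-identityˡ (b , a) = ×-≡,≡→≡ (ℤ₅.mod-toℕ b , (begin
    (toℕ (0 mod n) * i ^ toℕ b + toℕ a) mod n  ≡⟨ cong (λ k → (k * i ^ toℕ b + toℕ a) mod n) toℕ-0mod ⟩
    toℕ a mod n                                ≡⟨ mod-toℕ a ⟩
    a                                          ∎))

  ·-identityʳ : ∀ g → g · e ≡ g
  ·-identityʳ (b , a) = ×-≡,≡→≡
    ( trans (cong (_mod 5) (+-identityʳ (toℕ b))) (ℤ₅.mod-toℕ b)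
    , (begin
      (toℕ a * 1 + toℕ (0 mod n)) mod n  ≡⟨ cong₂ (λ k l → (k + l) mod n) (*-identityʳ (toℕ a)) toℕ-0mod ⟩
      (toℕ a + 0) mod n                  ≡⟨ cong (_mod n) (+-identityʳ (toℕ a)) ⟩
      toℕ a mod n                        ≡⟨ mod-toℕ a ⟩
      a                                  ∎))

  X-+ : ∀ a b → X (a + b) ≡ X a · X b
  X-+ a b = cong (0 mod 5 ,_) (%≡%⇒mod≡mod (sym
    (+-cong-% (trans (cong (_% n) (*-identityʳ _)) (toℕ-mod-% a)) (toℕ-mod-% b))))

  Y-+ : ∀ a b → Y (a + b) ≡ Y a · Y b
  Y-+ a b = ×-≡,≡→≡
    ( ℤ₅.%≡%⇒mod≡mod {a + b} {toℕ (a mod 5) + toℕ (b mod 5)}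
        (sym (ℤ₅.+-cong-% {toℕ (a mod 5)} {a} {toℕ (b mod 5)} {b} (ℤ₅.toℕ-mod-% a) (ℤ₅.toℕ-mod-% b)))
    , sym (cong₂ (λ k l → (k * i ^ toℕ (b mod 5) + l) mod n) toℕ-0mod toℕ-0mod))

  X-^ᴳ : ∀ a k → X a ^ᴳ k ≡ X (k * a)
  X-^ᴳ = +-homomorphism-^ᴳ X refl X-+

  x^k≡X : ∀ k → x ^ᴳ k ≡ X k
  x^k≡X k = trans (X-^ᴳ 1 k) (cong X (*-identityʳ k))

  y^k≡Y : ∀ k → y ^ᴳ k ≡ Y k
  y^k≡Y k = trans (+-homomorphism-^ᴳ Y refl Y-+ 1 k) (cong Y (*-identityʳ k))

  π-^ᴳ : ∀ g k → π (g ^ᴳ k) ≡ (k * π g) % 5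
  π-^ᴳ g zero    = refl
  π-^ᴳ g (suc k) = begin
    π (g · g ^ᴳ k)                ≡⟨ π-· g (g ^ᴳ k) ⟩
    (π g + π (g ^ᴳ k)) % 5        ≡⟨ cong (λ m → (π g + m) % 5) (π-^ᴳ g k) ⟩
    (π g + (k * π g) % 5) % 5     ≡⟨ ℤ₅.[m+n%d]%d≡[m+n]%d (π g) (k * π g) ⟩
    (suc k * π g) % 5             ∎

  decompose : ∀ g → g ≡ Y (π g) · X (σ g)
  decompose (b , a) = sym (×-≡,≡→≡
    ( trans (cong (_mod 5) (trans (+-identityʳ _) (cong toℕ (ℤ₅.mod-toℕ b)))) (ℤ₅.mod-toℕ b)
    , trans (cong₂ (λ k l → (k * 1 + toℕ l) mod n) toℕ-0mod (mod-toℕ a)) (mod-toℕ a)))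

  x^n≡e : x ^ᴳ n ≡ e
  x^n≡e = trans (x^k≡X n) (cong (0 mod 5 ,_) (%≡%⇒mod≡mod (trans (n%n≡0 n) (sym 0%d≡0))))

  x·y≡y·xⁱ : x · y ≡ y · X i
  x·y≡y·xⁱ = cong (1 mod 5 ,_) (%≡%⇒mod≡mod (begin
    (toℕ (1 mod n) * (i * 1) + toℕ (0 mod n)) % n
      ≡⟨ +-cong-% (*-cong-% (toℕ-mod-% 1) refl) (toℕ-mod-% 0) ⟩
    (1 * (i * 1) + 0) % n
      ≡⟨ cong (_% n) (trans (+-identityʳ _) (trans (*-identityˡ _) (*-identityʳ i))) ⟩
    i % n
      ≡⟨ toℕ-mod-% i ⟨
    toℕ (i mod n) % n
      ≡⟨ cong (λ k → (k * 1 + toℕ (i mod n)) % n) toℕ-0mod ⟨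
    (toℕ (0 mod n) * 1 + toℕ (i mod n)) % n ∎))

  shift : ℕ → G → G
  shift k (b , a) = b , (toℕ a + toℕ b * k) mod n

  shift-inverse : ∀ {k l} → l + k ≡ n → ∀ g → shift k (shift l g) ≡ g
  shift-inverse {k} {l} l+k≡n (b , a) = cong (b ,_) (trans (%≡%⇒mod≡mod (begin
    (toℕ ((toℕ a + toℕ b * l) mod n) + toℕ b * k) % n
      ≡⟨ +-cong-% (toℕ-mod-% (toℕ a + toℕ b * l)) refl ⟩
    (toℕ a + toℕ b * l + toℕ b * k) % n
      ≡⟨ cong (_% n) (+-assoc (toℕ a) _ _) ⟩
    (toℕ a + (toℕ b * l + toℕ b * k)) % n
      ≡⟨ cong (λ m → (toℕ a + m) % n) (*-distribˡ-+ (toℕ b) l k) ⟨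
    (toℕ a + toℕ b * (l + k)) % n
      ≡⟨ cong (λ m → (toℕ a + toℕ b * m) % n) l+k≡n ⟩
    (toℕ a + toℕ b * n) % n
      ≡⟨ %-remove-+ʳ (toℕ a) (n∣m*n (toℕ b)) ⟩
    toℕ a % n ∎)) (mod-toℕ a))

  shift-equivariant : ∀ k {s} → s ∈⟨x⟩ → ∀ g → shift k (s · g) ≡ s · shift k g
  shift-equivariant k {_ , c} refl (b , a) = cong (toℕ b mod 5 ,_) (%≡%⇒mod≡mod (begin
    (toℕ ((toℕ c * i ^ toℕ b + toℕ a) mod n) + toℕ (toℕ b mod 5) * k) % n
      ≡⟨ +-cong-% (toℕ-mod-% (toℕ c * i ^ toℕ b + toℕ a))
                  (cong (λ b′ → (toℕ b′ * k) % n) (ℤ₅.mod-toℕ b)) ⟩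
    (toℕ c * i ^ toℕ b + toℕ a + toℕ b * k) % n
      ≡⟨ cong (_% n) (+-assoc (toℕ c * i ^ toℕ b) (toℕ a) (toℕ b * k)) ⟩
    (toℕ c * i ^ toℕ b + (toℕ a + toℕ b * k)) % n
      ≡⟨ +-cong-% refl (toℕ-mod-% (toℕ a + toℕ b * k)) ⟨
    (toℕ c * i ^ toℕ b + toℕ ((toℕ a + toℕ b * k) mod n)) % n ∎))

  shift-fixes-⟨x⟩ : ∀ k {g} → g ∈⟨x⟩ → shift k g ≡ g
  shift-fixes-⟨x⟩ k {_ , a} refl =
    cong (Fin.zero ,_) (trans (cong (_mod n) (+-identityʳ (toℕ a))) (mod-toℕ a))

  shift-moves-y : shift 1 y ≢ y
  shift-moves-y shift-y≡y = 1+n≢0 (begin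
    1                                ≡⟨ 1%n≡1 ⟨
    1 % n                            ≡⟨ cong (λ m → (m + 1) % n) toℕ-0mod ⟨
    (toℕ (0 mod n) + 1) % n          ≡⟨ toℕ-mod (toℕ (0 mod n) + 1) ⟨
    σ (shift 1 y)                    ≡⟨ cong σ shift-y≡y ⟩
    σ y                              ≡⟨ toℕ-0mod ⟩
    0                                ∎)

  open Cayley _·_ e
  open CayleyAutomorphisms _·_ e

  ∈⇒Adj-e : ∀ {S s} → s ∈ S → Adj S e s
  ∈⇒Adj-e {s = s} s∈S = s , s∈S , sym (·-identityʳ s)

  ⊆⟨x⟩⇒¬oneRegular : ∀ {S s} → s ∈ S → All _∈⟨x⟩ S → ¬ OneRegular S
  ⊆⟨x⟩⇒¬oneRegular {S} {s} s∈S S⊆⟨x⟩ oneRegular =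
    shift-moves-y (oneRegular⇒arcStabiliser-trivial oneRegular (∈⇒Adj-e s∈S) shiftAut
      (shift-fixes-⟨x⟩ 1 refl) (shift-fixes-⟨x⟩ 1 (All.lookup S⊆⟨x⟩ s∈S)) y)
    where
    1≤n : 1 ≤ n
    1≤n = >-nonZero⁻¹ n
    shiftAut : Aut S
    shiftAut = leftEquivariant⇒Aut (shift 1) (shift (n ∸ 1))
      (shift-inverse (m+[n∸m]≡n 1≤n)) (shift-inverse (m∸n+n≡m 1≤n))
      (λ {s} s∈S → shift-equivariant 1 {s} (All.lookup S⊆⟨x⟩ s∈S))

  module Endomorphism (5∤n : 5 ∤ n) (A : G → G) (A-e : A e ≡ e)
                      (A-· : ∀ g h → A (g · h) ≡ A g · A h) where

    A-^ᴳ : ∀ g k → A (g ^ᴳ k) ≡ A g ^ᴳ k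
    A-^ᴳ = homomorphism-^ᴳ A A-e A-·

    A-x∈⟨x⟩ : A x ∈⟨x⟩
    A-x∈⟨x⟩ = toℕ-injective (∣∧<⇒≡0 5∣π-A-x (toℕ<n (proj₁ (A x))))
      where
      n*π-A-x≡0 : (n * π (A x)) % 5 ≡ 0
      n*π-A-x≡0 = begin
        (n * π (A x)) % 5  ≡⟨ π-^ᴳ (A x) n ⟨
        π (A x ^ᴳ n)       ≡⟨ cong π (A-^ᴳ x n) ⟨
        π (A (x ^ᴳ n))     ≡⟨ cong (π ∘ A) x^n≡e ⟩
        π (A e)            ≡⟨ cong π A-e ⟩
        0                  ∎
      5∣π-A-x : 5 ∣ π (A x)
      5∣π-A-x = prime∣m*n∧∤m⇒∣n n (π (A x)) prime[5] 5∤n (m%n≡0⇒n∣m _ 5 n*π-A-x≡0)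

    u : ℕ
    u = σ (A x)

    A-X : ∀ k → A (X k) ≡ X (k * u)
    A-X k = begin
      A (X k)       ≡⟨ cong A (x^k≡X k) ⟨
      A (x ^ᴳ k)    ≡⟨ A-^ᴳ x k ⟩
      A x ^ᴳ k      ≡⟨ cong (_^ᴳ k) (×-≡,≡→≡ (A-x∈⟨x⟩ , sym (mod-toℕ (proj₂ (A x))))) ⟩
      X u ^ᴳ k      ≡⟨ X-^ᴳ u k ⟩
      X (k * u)     ∎

    π-A : ∀ g → π (A g) ≡ (π g * π (A y)) % 5
    π-A g = begin
      π (A g)                                ≡⟨ cong (π ∘ A) (decompose g) ⟩
      π (A (Y (π g) · X (σ g)))              ≡⟨ cong π (A-· (Y (π g)) (X (σ g))) ⟩
      π (A (Y (π g)) · A (X (σ g)))          ≡⟨ π-· (A (Y (π g))) (A (X (σ g))) ⟩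
      (π (A (Y (π g))) + π (A (X (σ g)))) % 5  ≡⟨ cong (λ h → (π (A (Y (π g))) + π h) % 5) (A-X (σ g)) ⟩
      (π (A (Y (π g))) + 0) % 5              ≡⟨ cong (_% 5) (+-identityʳ (π (A (Y (π g))))) ⟩
      π (A (Y (π g))) % 5                    ≡⟨ m<n⇒m%n≡m (toℕ<n (proj₁ (A (Y (π g))))) ⟩
      π (A (Y (π g)))                        ≡⟨ cong (π ∘ A) (y^k≡Y (π g)) ⟨
      π (A (y ^ᴳ π g))                       ≡⟨ cong π (A-^ᴳ y (π g)) ⟩
      π (A y ^ᴳ π g)                         ≡⟨ π-^ᴳ (A y) (π g) ⟩
      (π g * π (A y)) % 5                    ∎

    π-A-y≡4 : ∀ {s t} → A s ≡ t → t · s ≡ e → ¬ s ∈⟨x⟩ → π (A y) ≡ 4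
    π-A-y≡4 {s} {t} A-s≡t t·s≡e s∉⟨x⟩ =
      suc-injective (≤-antisym (toℕ<n (proj₁ (A y))) (∣⇒≤ 5∣1+d))
      where
      b = π s
      d = π (A y)
      b*[1+d]≡0 : (b * suc d) % 5 ≡ 0
      b*[1+d]≡0 = begin
        (b * suc d) % 5        ≡⟨ cong (_% 5) (trans (*-suc b d) (+-comm b (b * d))) ⟩
        (b * d + b) % 5        ≡⟨ ℤ₅.[m%d+n]%d≡[m+n]%d (b * d) b ⟨
        ((b * d) % 5 + b) % 5  ≡⟨ cong (λ m → (m + b) % 5) (trans (sym (π-A s)) (cong π A-s≡t)) ⟩
        (π t + π s) % 5        ≡⟨ π-· t s ⟨
        π (t · s)              ≡⟨ cong π t·s≡e ⟩
        0                      ∎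
      5∤b : 5 ∤ b
      5∤b 5∣b = s∉⟨x⟩ (toℕ-injective (∣∧<⇒≡0 5∣b (toℕ<n (proj₁ s))))
      5∣1+d : 5 ∣ suc d
      5∣1+d = prime∣m*n∧∤m⇒∣n b (suc d) prime[5] 5∤b (m%n≡0⇒n∣m _ 5 b*[1+d]≡0)

    π-A-y≡4⇒i⁴≡i : π (A y) ≡ 4 → (∀ {g h} → A g ≡ A h → g ≡ h) → i ^ 4 % n ≡ i % n
    π-A-y≡4⇒i⁴≡i π-A-y≡4 A-injective = begin
      i ^ 4 % n          ≡⟨ toℕ-mod (i ^ 4) ⟨
      σ (X (i ^ 4))      ≡⟨ cong σ (A-injective (trans (A-X (i ^ 4)) (trans X[i⁴u]≡X[iu] (sym (A-X i))))) ⟩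
      σ (X i)            ≡⟨ toℕ-mod i ⟩
      i % n              ∎
      where
      v = σ (A y)
      Ax·Ay≡Ay·Axⁱ : A x · A y ≡ A y · A (X i)
      Ax·Ay≡Ay·Axⁱ = trans (sym (A-· x y)) (trans (cong A x·y≡y·xⁱ) (A-· y (X i)))
      u*i⁴+v≡i*u+v : (u * i ^ 4 + v) % n ≡ (i * u + v) % n
      u*i⁴+v≡i*u+v = begin
        (u * i ^ 4 + v) % n                   ≡⟨ cong (λ k → (u * i ^ k + v) % n) π-A-y≡4 ⟨
        (u * i ^ π (A y) + v) % n             ≡⟨ σ-· (A x) (A y) ⟨
        σ (A x · A y)                         ≡⟨ cong σ Ax·Ay≡Ay·Axⁱ ⟩
        σ (A y · A (X i))                     ≡⟨ cong (λ h → σ (A y · h)) (A-X i) ⟩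
        σ (A y · X (i * u))                   ≡⟨ σ-· (A y) (X (i * u)) ⟩
        (v * 1 + toℕ ((i * u) mod n)) % n     ≡⟨ +-cong-% (cong (_% n) (*-identityʳ v)) (toℕ-mod-% _) ⟩
        (v + i * u) % n                       ≡⟨ cong (_% n) (+-comm v (i * u)) ⟩
        (i * u + v) % n                       ∎
      X[i⁴u]≡X[iu] : X (i ^ 4 * u) ≡ X (i * u)
      X[i⁴u]≡X[iu] = cong (0 mod 5 ,_) (%≡%⇒mod≡mod
        (trans (cong (_% n) (*-comm (i ^ 4) u)) (+-cancelʳ-% (u * i ^ 4) (i * u) v u*i⁴+v≡i*u+v)))

  oneRegular∧normal∧⊈⟨x⟩⇒i⁴≡i : 5 ∤ n → ∀ {S s} → IsCayleySubset S → s ∈ S → ¬ s ∈⟨x⟩ →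
                                OneRegular S → IsNormal S → i ^ 4 % n ≡ i % n
  oneRegular∧normal∧⊈⟨x⟩⇒i⁴≡i 5∤n {S} {s} (_ , _ , inverse-closed) s∈S s∉⟨x⟩ oneRegular normal
    with inverse-closed s s∈S
  ... | t , t∈S , t·s≡e with oneRegular e s e t (∈⇒Adj-e s∈S) (∈⇒Adj-e t∈S)
  ... | α , (α-e≡e , α-s≡t) , _ =
    π-A-y≡4⇒i⁴≡i (π-A-y≡4 α-s≡t t·s≡e s∉⟨x⟩) α-injective
    where
    open Endomorphism 5∤n (fun α) α-e≡e (normal⇒homomorphism ·-identityˡ normal α α-e≡e)
    α-injective : ∀ {g h} → fun α g ≡ fun α h → g ≡ h
    α-injective {g} {h} αg≡αh =
      trans (sym (inv-fun α g)) (trans (cong (inv α) αg≡αh) (inv-fun α h))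

  oneRegular⇒⊈⟨x⟩ : ∀ {s S} → OneRegular (s ∷ S) → ∃ λ t → t ∈ s ∷ S × ¬ t ∈⟨x⟩
  oneRegular⇒⊈⟨x⟩ {s} {S} oneRegular with all? _∈⟨x⟩? (s ∷ S)
  ... | yes ⊆⟨x⟩ = contradiction oneRegular (⊆⟨x⟩⇒¬oneRegular (here refl) ⊆⟨x⟩)
  ... | no ⊈⟨x⟩  = find (¬All⇒Any¬ _∈⟨x⟩? (s ∷ S) ⊈⟨x⟩)

5∤p*p : ∀ {p} → Prime p → 5 < p → 5 ∤ p * p
5∤p*p {p} p-prime 5<p 5∣p*p = [ 5∤p , 5∤p ]′ (euclidsLemma p p prime[5] 5∣p*p)
  where
  5∤p : 5 ∤ p
  5∤p 5∣p = Prime.notComposite p-prime (composite 5<p 5∣p)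

lemma3p2 : (p : ℕ) (pp : Prime p) → 5 < p →
    (i : ℕ) → (∃ λ k → i ^ 5 ≡ 1 + k * (p * p)) →
    (¬ ∃ λ k → i ≡ 1 + k * (p * p)) →
    let open Metacyclic p pp i in
    let open Cayley _·_ e in
    (S : List G) → IsCayleySubset S → length S ≡ 4 →
    OneRegular S → IsNormal S → ⊥
lemma3p2 p pp 5<p i _ i≢1 [] _ () _ _
lemma3p2 p pp 5<p i (k , i⁵≡1+k*n) i≢1 (_ ∷ _) cayley _ oneRegular normal =
  i≢1 (i / n , (begin
    i                  ≡⟨ m≡m%n+[m/n]*n i n ⟩
    i % n + i / n * n  ≡⟨ cong (_+ i / n * n) (trans i≡1 1%n≡1) ⟩
    1 + i / n * n      ∎))
  where
  open MetacyclicProperties p pp i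
  open ≡-Reasoning
  i⁴≡i : i ^ 4 % n ≡ i % n
  i⁴≡i = let s , s∈S , s∉⟨x⟩ = oneRegular⇒⊈⟨x⟩ oneRegular in
    oneRegular∧normal∧⊈⟨x⟩⇒i⁴≡i (5∤p*p pp 5<p) cayley s∈S s∉⟨x⟩ oneRegular normal
  i⁵≡1 : i ^ 5 % n ≡ 1 % n
  i⁵≡1 = trans (cong (_% n) i⁵≡1+k*n) ([m+kn]%n≡m%n 1 k n)
  i≡1 : i % n ≡ 1 % n
  i≡1 = i⁴≡i∧i⁵≡1⇒i≡1 i i⁴≡i i⁵≡1
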